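{- (i) The maximum size of a set of mutually orthogoval affine planes of order $4$ (each isomorphic to $\mathrm{AG}(2,4)$) on a common point set is seven. (ii) There exists a set of seven mutually orthogoval affine planes of order $8$, each isomorphic to $\mathrm{AG}(2,8)$, on a common point set.
   Context: Two planes, both projective or both affine, of the same order and on the same point set are called orthogoval if every line of one plane intersects every line of the other plane in at most two points. A set of planes is a set of mutually orthogoval planes if the planes are pairwise orthogoval. -}

module Defs where

open import Data.Nat using (ℕ; suc; _≤_)
open import Data.Bool using (Bool; true; false; if_then_else_; _xor_)
open import Data.Vec using (Vec; []; _∷_; zipWith; replicate; init; last; foldr; lookup)
open import Data.Fin using (Fin)
open import Data.Fin.Subset using (Subset; _∩_; ∣_∣)
open import Data.Product using (Σ; _×_; _,_; ∃)
open import Data.Sum using (_⊎_)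
open import Function.Bundles using (_↔_; _⇔_; Inverse)
open import Relation.Binary.PropositionalEquality using (_≡_; _≢_)

-- The finite field GF(2^k), k ≥ 1, realised as GF(2)[x]/(f(x)) where
-- f(x) = x^k + r(x) is irreducible over GF(2) (deg r < k).
-- An element is its coefficient vector (a₀, …, a_{k-1}) (low to high);
-- the reduction polynomial is given by r = (r₀, …, r_{k-1}), i.e. x^k = r(x).

GF : ℕ → Set
GF k = Vec Bool k

zeroF : ∀ {k} → GF k
zeroF = replicate _ false

addF : ∀ {k} → GF k → GF k → GF k
addF = zipWith _xor_

mulX : ∀ {k} → GF (suc k) → GF (suc k) → GF (suc k)
mulX r v = addF (false ∷ init v) (if last v then r else zeroF)

mulF : ∀ {k} → GF (suc k) → GF (suc k) → GF (suc k) → GF (suc k)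
mulF {k} r a b = foldr (λ _ → GF (suc k)) (λ aᵢ acc → addF (if aᵢ then b else zeroF) (mulX r acc)) zeroF a

-- GF(4) = GF(2)[x]/(x² + x + 1) :  x² = 1 + x
r4 : GF 2
r4 = true ∷ true ∷ []

-- GF(8) = GF(2)[x]/(x³ + x + 1) :  x³ = 1 + x
r8 : GF 3
r8 = true ∷ true ∷ false ∷ []

AGPoint : ℕ → Set
AGPoint k = GF k × GF k

IsAGLine : ∀ {k} → GF (suc k) → (AGPoint (suc k) → Bool) → Set
IsAGLine r S =
    (Σ (GF _) λ m → Σ (GF _) λ b → ∀ x y → (S (x , y) ≡ true) ⇔ (y ≡ addF (mulF r m x) b))
  ⊎ (Σ (GF _) λ c → ∀ x y → (S (x , y) ≡ true) ⇔ (x ≡ c))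

-- Planes on the common point set Fin n.  A plane is given by its set of
-- lines, a predicate on subsets of the point set.

Plane : ℕ → Set₁
Plane n = Subset n → Set

-- π is isomorphic to AG(2, 2^(suc k)) (with field given by r): there is a
-- bijection between the points of π and those of AG(2,·) carrying the lines
-- of π exactly onto the lines of AG(2,·).  (This in particular makes π an
-- affine plane of order 2^(suc k).)
IsoToAG : ∀ {n k} → GF (suc k) → Plane n → Set
IsoToAG {n} {k} r π =
  Σ (Fin n ↔ AGPoint (suc k)) λ f →
    ∀ (L : Subset n) → π L ⇔ IsAGLine r (λ p → lookup L (Inverse.from f p))

Orthogoval : ∀ {n} → Plane n → Plane n → Set
Orthogoval π₁ π₂ = ∀ L₁ L₂ → π₁ L₁ → π₂ L₂ → ∣ L₁ ∩ L₂ ∣ ≤ 2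

MutuallyOrthogoval : ∀ {n m} → (Fin m → Plane n) → Set
MutuallyOrthogoval π = ∀ i j → i ≢ j → Orthogoval (π i) (π j)

module Submission where

-- Two distinct points a, b of AG(2,4) lie on a line with two further points. In m mutually
-- orthogoval planes ≅ AG(2,4) on 16 points, the further points on the lines through a and b
-- differ from plane to plane, since lines of distinct planes share at most two points; hence
-- 2 + 2m ≤ 16, i.e. m ≤ 7.
-- Both families of seven planes are orbits: the lines of plane d are the σᵈ-preimages of the
-- lines of AG(2,q), for a permutation σ of the points of order 7. Relabelling points preserves
-- orthogovality, so planes i and i + d are orthogoval as soon as planes 0 and d are, and these
-- six conditions are checked by evaluation.

open import Defs
open import Algebra.Properties.CommutativeMonoid.Sum as Sum using ()
open import Data.Bool using (Bool; true; false; if_then_else_; _∧_)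
open import Data.Bool.Properties using () renaming (_≟_ to _≟ᴮ_)
open import Data.Empty using (⊥-elim)
open import Data.Fin using (Fin; zero; suc; toℕ; fromℕ<; #_)
open import Data.Fin.Permutation using (Permutation′; permutation; _⟨$⟩ʳ_; _⟨$⟩ˡ_; flip)
open import Data.Fin.Properties
  using (all?; any?; injective⇒≤; toℕ-injective; toℕ<n; toℕ-fromℕ<; *↔×; +↔⊎; 2↔Bool)
  renaming (_≟_ to _≟ᶠ_)
open import Data.Fin.Subset using (Subset; _∩_; _─_; ⁅_⁆; ∣_∣; _∈_)
open import Data.Fin.Subset.Properties
  using (p∩q≢∅⇒∣p─q∣<∣p∣; x∈p∧x∉q⇒x∈p─q; x∈p∩q⁺; x∈⁅x⁆; x≢y⇒x∉⁅y⁆; ∩-comm)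
open import Data.List using (List; []; _∷_; map; _++_; allFin; cartesianProductWith)
open import Data.List.Membership.Propositional using (lose) renaming (_∈_ to _∈ˡ_)
open import Data.List.Membership.Propositional.Properties
  using (∈-map⁺; ∈-allFin; ∈-++⁺ˡ; ∈-++⁺ʳ; ∈-cartesianProductWith⁺)
open import Data.List.Relation.Unary.All as All using (All; []; _∷_)
open import Data.List.Relation.Unary.AllPairs using ([]; _∷_)
open import Data.List.Relation.Unary.Unique.Propositional using (Unique)
open import Data.List.Relation.Unary.Unique.DecPropositional using (unique?)
open import Data.List.Relation.Unary.Any using (satisfied)
  renaming (any? to anyˡ?)
open import Data.Nat using (ℕ; zero; suc; _+_; _*_; _∸_; _^_; _≤_; _<_; _≤?_; _<?_; z≤n)
open import Data.Nat.Properties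
  using (≤-<-trans; <⇒≤; <⇒≱; <-cmp; m+[n∸m]≡n; m<n⇒0<n∸m; m∸n≤m; +-cancelˡ-≤; *-cancelʳ-≤;
         +-0-commutativeMonoid)
open import Data.Product using (Σ; ∃; ∃₂; _×_; _,_; uncurry)
open import Data.Product.Function.NonDependent.Propositional using (_×-↔_)
open import Data.Product.Properties using () renaming (≡-dec to ×-≡-dec)
open import Data.Sum using (_⊎_; inj₁; inj₂)
open import Data.Sum.Function.Propositional using (_⊎-↔_)
open import Data.Vec using (Vec; []; _∷_; lookup; tabulate)
  renaming (map to mapᵛ)
open import Data.Vec.Properties
  using (lookup∘tabulate; tabulate∘lookup; tabulate-cong; lookup-map; lookup-zipWith; lookup⇒[]=)
  renaming (≡-dec to Vec-≡-dec)
open import Function using (_∘_; _$_)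
open import Function.Bundles using (_↔_; _⇔_; Inverse; Equivalence; Injection; mk⇔; mk↔ₛ′)
open import Function.Properties.Inverse using (↔⇒↣)
open import Function.Construct.Composition using (_↔-∘_)
open import Function.Construct.Identity using (↔-id)
open import Function.Construct.Symmetry using (↔-sym)
open import Function.Definitions using (Injective)
open import Function.Properties.Equivalence using () renaming (refl to ⇔-refl; trans to ⇔-trans)
open import Relation.Binary.Definitions using (DecidableEquality; tri<; tri≈; tri>)
open import Relation.Binary.PropositionalEquality
open import Relation.Nullary using (Dec; does; yes; no; ¬?; _×-dec_; _→-dec_)
open import Relation.Nullary.Decidable using (dec-true; dec-false; from-yes; True; toWitness; map′)
open import Relation.Unary using (Decidable)

private
  variable
    k m n : ℕ
    a b x y z : Fin n
    p : Subset n
    π π₁ π₂ : Plane n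

-- The counting bound

x∈p⇒∣p─⁅x⁆∣<∣p∣ : x ∈ p → ∣ p ─ ⁅ x ⁆ ∣ < ∣ p ∣
x∈p⇒∣p─⁅x⁆∣<∣p∣ {x = x} {p = p} x∈p = p∩q≢∅⇒∣p─q∣<∣p∣ p ⁅ x ⁆ (x , x∈p∩q⁺ (x∈p , x∈⁅x⁆ x))

y∈p─⁅x⁆ : y ∈ p → y ≢ x → y ∈ p ─ ⁅ x ⁆
y∈p─⁅x⁆ y∈p y≢x = x∈p∧x∉q⇒x∈p─q y∈p (x≢y⇒x∉⁅y⁆ y≢x)

k≤∣p─⁅x⁆∣⇒k<∣p∣ : x ∈ p → k ≤ ∣ p ─ ⁅ x ⁆ ∣ → k < ∣ p ∣
k≤∣p─⁅x⁆∣⇒k<∣p∣ x∈p k≤ = ≤-<-trans k≤ (x∈p⇒∣p─⁅x⁆∣<∣p∣ x∈p)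

2<∣p∣ : x ∈ p → y ∈ p → z ∈ p → x ≢ y → x ≢ z → y ≢ z → 2 < ∣ p ∣
2<∣p∣ x∈p y∈p z∈p x≢y x≢z y≢z =
  k≤∣p─⁅x⁆∣⇒k<∣p∣ x∈p $
  k≤∣p─⁅x⁆∣⇒k<∣p∣ (y∈p─⁅x⁆ y∈p (x≢y ∘ sym)) $
  k≤∣p─⁅x⁆∣⇒k<∣p∣ (y∈p─⁅x⁆ (y∈p─⁅x⁆ z∈p (x≢z ∘ sym)) (y≢z ∘ sym)) z≤n

record LineThrough (π : Plane n) (a b : Fin n) (k : ℕ) : Set where
  field
    line            : Subset n
    isLine          : π line
    a∈line          : a ∈ line
    b∈line          : b ∈ line
    extra           : Fin k → Fin n
    extra-injective : Injective _≡_ _≡_ extra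
    extra∈line      : ∀ u → extra u ∈ line
    extra≢a         : ∀ u → extra u ≢ a
    extra≢b         : ∀ u → extra u ≢ b

module _ {π : Fin m → Plane n} (a≢b : a ≢ b) (through : ∀ i → LineThrough (π i) a b k)
         (mo : MutuallyOrthogoval π) where
  open LineThrough

  -- Lines of distinct planes would otherwise share a, b and this point.
  extra-plane-injective : ∀ {i j u v} → extra (through i) u ≡ extra (through j) v → i ≡ j
  extra-plane-injective {i} {j} {u} {v} e with i ≟ᶠ j
  ... | yes i≡j = i≡j
  ... | no i≢j  = ⊥-elim (<⇒≱ 2<∣common∣ (mo i j i≢j _ _ (isLine (through i)) (isLine (through j))))
    where
    common : ∀ {x} → x ∈ line (through i) → x ∈ line (through j) → x ∈ line (through i) ∩ line (through j)
    common x∈i x∈j = x∈p∩q⁺ (x∈i , x∈j)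
    2<∣common∣ : 2 < ∣ line (through i) ∩ line (through j) ∣
    2<∣common∣ = 2<∣p∣ (common (a∈line (through i)) (a∈line (through j)))
      (common (b∈line (through i)) (b∈line (through j)))
      (common (extra∈line (through i) u) (subst (_∈ line (through j)) (sym e) (extra∈line (through j) v)))
      a≢b (extra≢a (through i) u ∘ sym) (extra≢b (through i) u ∘ sym)

  point : Fin 2 ⊎ (Fin m × Fin k) → Fin n
  point (inj₁ zero)       = a
  point (inj₁ (suc zero)) = b
  point (inj₂ (i , u))    = extra (through i) u

  point-injective : Injective _≡_ _≡_ point
  point-injective {inj₁ zero}       {inj₁ zero}       _ = refl
  point-injective {inj₁ zero}       {inj₁ (suc zero)} e = ⊥-elim (a≢b e)
  point-injective {inj₁ (suc zero)} {inj₁ zero}       e = ⊥-elim (a≢b (sym e))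
  point-injective {inj₁ (suc zero)} {inj₁ (suc zero)} _ = refl
  point-injective {inj₁ zero}       {inj₂ (j , v)}    e = ⊥-elim (extra≢a (through j) v (sym e))
  point-injective {inj₁ (suc zero)} {inj₂ (j , v)}    e = ⊥-elim (extra≢b (through j) v (sym e))
  point-injective {inj₂ (i , u)}    {inj₁ zero}       e = ⊥-elim (extra≢a (through i) u e)
  point-injective {inj₂ (i , u)}    {inj₁ (suc zero)} e = ⊥-elim (extra≢b (through i) u e)
  point-injective {inj₂ (i , u)}    {inj₂ (j , v)}    e with refl ← extra-plane-injective e =
    cong (inj₂ ∘ (i ,_)) (extra-injective (through i) e)

  mutuallyOrthogoval-bound : 2 + m * k ≤ n
  mutuallyOrthogoval-bound =
    injective⇒≤ {f = point ∘ Inverse.to indices} (Injection.injective (↔⇒↣ indices) ∘ point-injective)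
    where
    indices : Fin (2 + m * k) ↔ (Fin 2 ⊎ (Fin m × Fin k))
    indices = (↔-id _ ⊎-↔ *↔×) ↔-∘ +↔⊎

-- Relabelling points

preimage : (Fin n → Fin n) → Subset n → Subset n
preimage f p = tabulate (lookup p ∘ f)

lookup-ext : {A : Set} {u v : Vec A n} → (∀ i → lookup u i ≡ lookup v i) → u ≡ v
lookup-ext {u = u} {v} u≗v = trans (sym (tabulate∘lookup u)) (trans (tabulate-cong u≗v) (tabulate∘lookup v))

preimage-∩ : (f : Fin n → Fin n) (p q : Subset n) → preimage f (p ∩ q) ≡ preimage f p ∩ preimage f q
preimage-∩ f p q = lookup-ext λ i → begin
  lookup (preimage f (p ∩ q)) i                      ≡⟨ lookup∘tabulate _ i ⟩
  lookup (p ∩ q) (f i)                               ≡⟨ lookup-zipWith _∧_ (f i) p q ⟩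
  lookup p (f i) ∧ lookup q (f i)                    ≡⟨ cong₂ _∧_ (lookup∘tabulate _ i) (lookup∘tabulate _ i) ⟨
  lookup (preimage f p) i ∧ lookup (preimage f q) i  ≡⟨ lookup-zipWith _∧_ i (preimage f p) (preimage f q) ⟨
  lookup (preimage f p ∩ preimage f q) i             ∎
  where open ≡-Reasoning

module _ where
  open Sum +-0-commutativeMonoid using (sum; sum-permute; sum-cong-≗)

  indicator : Bool → ℕ
  indicator b = if b then 1 else 0

  ∣p∣≡sum : (p : Subset n) → ∣ p ∣ ≡ sum (indicator ∘ lookup p)
  ∣p∣≡sum []          = refl
  ∣p∣≡sum (true ∷ p)  = cong suc (∣p∣≡sum p)
  ∣p∣≡sum (false ∷ p) = ∣p∣≡sum p

  ∣preimage∣ : (σ : Permutation′ n) (p : Subset n) → ∣ preimage (σ ⟨$⟩ʳ_) p ∣ ≡ ∣ p ∣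
  ∣preimage∣ σ p = begin
    ∣ preimage (σ ⟨$⟩ʳ_) p ∣                         ≡⟨ ∣p∣≡sum (preimage (σ ⟨$⟩ʳ_) p) ⟩
    sum (indicator ∘ lookup (preimage (σ ⟨$⟩ʳ_) p))  ≡⟨ sum-cong-≗ (cong indicator ∘ lookup∘tabulate (lookup p ∘ (σ ⟨$⟩ʳ_))) ⟩
    sum (indicator ∘ lookup p ∘ (σ ⟨$⟩ʳ_))           ≡⟨ sum-permute (indicator ∘ lookup p) σ ⟨
    sum (indicator ∘ lookup p)                       ≡⟨ ∣p∣≡sum p ⟨
    ∣ p ∣                                            ∎
    where open ≡-Reasoning

pullback : Permutation′ n → Plane n → Plane n
pullback σ π L = π (preimage (σ ⟨$⟩ˡ_) L)

orbit : Permutation′ n → Plane n → ℕ → Plane n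
orbit σ π zero    = π
orbit σ π (suc d) = pullback σ (orbit σ π d)

orthogoval-sym : Orthogoval π₁ π₂ → Orthogoval π₂ π₁
orthogoval-sym o L₁ L₂ π₂L₁ π₁L₂ = subst (_≤ 2) (cong ∣_∣ (∩-comm L₂ L₁)) (o L₂ L₁ π₁L₂ π₂L₁)

pullback-orthogoval : (σ : Permutation′ n) → Orthogoval π₁ π₂ → Orthogoval (pullback σ π₁) (pullback σ π₂)
pullback-orthogoval σ o L₁ L₂ π₁L₁ π₂L₂ = subst (_≤ 2) ∣L₁∩L₂∣ (o _ _ π₁L₁ π₂L₂)
  where
  ∣L₁∩L₂∣ : ∣ preimage (σ ⟨$⟩ˡ_) L₁ ∩ preimage (σ ⟨$⟩ˡ_) L₂ ∣ ≡ ∣ L₁ ∩ L₂ ∣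
  ∣L₁∩L₂∣ = trans (cong ∣_∣ (sym (preimage-∩ _ L₁ L₂))) (∣preimage∣ (flip σ) (L₁ ∩ L₂))

orbit-orthogoval : (σ : Permutation′ n) {d : ℕ} → Orthogoval π (orbit σ π d)
  → ∀ i → Orthogoval (orbit σ π i) (orbit σ π (i + d))
orbit-orthogoval σ o zero    = o
orbit-orthogoval σ o (suc i) = pullback-orthogoval σ (orbit-orthogoval σ o i)

orbit-orthogoval-< : (σ : Permutation′ n)
  → (∀ (d : Fin m) → 0 < toℕ d → Orthogoval π (orbit σ π (toℕ d)))
  → {i j : Fin m} → toℕ i < toℕ j → Orthogoval (orbit σ π (toℕ i)) (orbit σ π (toℕ j))
orbit-orthogoval-< {m = m} {π = π} σ base {i} {j} i<j =
  subst (Orthogoval _ ∘ orbit σ π) (m+[n∸m]≡n (<⇒≤ i<j)) (orbit-orthogoval σ base-d (toℕ i))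
  where
  d<m : toℕ j ∸ toℕ i < m
  d<m = ≤-<-trans (m∸n≤m (toℕ j) (toℕ i)) (toℕ<n j)
  d : Fin m
  d = fromℕ< d<m
  base-d : Orthogoval π (orbit σ π (toℕ j ∸ toℕ i))
  base-d = subst (Orthogoval π ∘ orbit σ π) (toℕ-fromℕ< d<m)
    (base d (subst (0 <_) (sym (toℕ-fromℕ< d<m)) (m<n⇒0<n∸m i<j)))

orbit-mutuallyOrthogoval : (σ : Permutation′ n)
  → (∀ (d : Fin m) → 0 < toℕ d → Orthogoval π (orbit σ π (toℕ d)))
  → MutuallyOrthogoval (orbit σ π ∘ toℕ)
orbit-mutuallyOrthogoval σ base i j i≢j with <-cmp (toℕ i) (toℕ j)
... | tri< i<j _ _ = orbit-orthogoval-< σ base i<j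
... | tri≈ _ i≡j _ = ⊥-elim (i≢j (toℕ-injective i≡j))
... | tri> _ _ j<i = orthogoval-sym (orbit-orthogoval-< σ base j<i)

data AGLine (k : ℕ) : Set where
  nonVertical : (m b : GF (suc k)) → AGLine k
  vertical    : (c : GF (suc k)) → AGLine k

_≟ᴳ_ : DecidableEquality (GF k)
_≟ᴳ_ = Vec-≡-dec _≟ᴮ_

_≟ᴾ_ : DecidableEquality (AGPoint k)
_≟ᴾ_ = ×-≡-dec _≟ᴳ_ _≟ᴳ_

onLine : GF (suc k) → AGLine k → AGPoint (suc k) → Bool
onLine r (nonVertical m b) (x , y) = does (y ≟ᴳ addF (mulF r m x) b)
onLine r (vertical c)      (x , y) = does (x ≟ᴳ c)

OnLine : GF (suc k) → AGLine k → AGPoint (suc k) → Set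
OnLine r ℓ q = onLine r ℓ q ≡ true

does≡true⇔ : {P : Set} (P? : Dec P) → does P? ≡ true ⇔ P
does≡true⇔ (yes p) = mk⇔ (λ _ → p) (λ _ → refl)
does≡true⇔ (no ¬p) = mk⇔ (λ ()) (⊥-elim ∘ ¬p)

⇔⇒≡does : {P : Set} {c : Bool} (P? : Dec P) → c ≡ true ⇔ P → c ≡ does P?
⇔⇒≡does {c = true}  P? c⇔P = sym (dec-true P? (Equivalence.to c⇔P refl))
⇔⇒≡does {c = false} P? c⇔P = sym (dec-false P? (λ p → false≢true (Equivalence.from c⇔P p)))
  where
  false≢true : false ≢ true
  false≢true ()

≡does⇒⇔ : {P : Set} {c : Bool} (P? : Dec P) → c ≡ does P? → c ≡ true ⇔ P
≡does⇒⇔ P? refl = does≡true⇔ P?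

isAGLine⇔ : {r : GF (suc k)} {S : AGPoint (suc k) → Bool} → IsAGLine r S ⇔ ∃ λ ℓ → S ≗ onLine r ℓ
isAGLine⇔ {r = r} = mk⇔ to from
  where
  to : IsAGLine _ _ → ∃ _
  to (inj₁ (m , b , S⇔)) = nonVertical m b , λ (x , y) → ⇔⇒≡does (y ≟ᴳ addF (mulF r m x) b) (S⇔ x y)
  to (inj₂ (c , S⇔))     = vertical c      , λ (x , y) → ⇔⇒≡does (x ≟ᴳ c) (S⇔ x y)
  from : ∃ _ → IsAGLine _ _
  from (nonVertical m b , S≗) = inj₁ (m , b , λ x y → ≡does⇒⇔ (y ≟ᴳ addF (mulF r m x) b) (S≗ (x , y)))
  from (vertical c , S≗)      = inj₂ (c , λ x y → ≡does⇒⇔ (x ≟ᴳ c) (S≗ (x , y)))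

isAGLine-cong : {r : GF (suc k)} {S S′ : AGPoint (suc k) → Bool} → S ≗ S′ → IsAGLine r S ⇔ IsAGLine r S′
isAGLine-cong S≗S′ = mk⇔
  (λ l → let ℓ , S≗ = Equivalence.to isAGLine⇔ l in Equivalence.from isAGLine⇔ (ℓ , λ q → trans (sym (S≗S′ q)) (S≗ q)))
  (λ l → let ℓ , S≗ = Equivalence.to isAGLine⇔ l in Equivalence.from isAGLine⇔ (ℓ , λ q → trans (S≗S′ q) (S≗ q)))

labelledAG : GF (suc k) → Fin n ↔ AGPoint (suc k) → Plane n
labelledAG r f L = IsAGLine r (lookup L ∘ Inverse.from f)

labelledAG-isoToAG : {r : GF (suc k)} {f : Fin n ↔ AGPoint (suc k)} → IsoToAG r (labelledAG r f)
labelledAG-isoToAG {f = f} = f , λ _ → ⇔-refl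

pullback-isoToAG : {r : GF (suc k)} (σ : Permutation′ n) → IsoToAG r π → IsoToAG r (pullback σ π)
pullback-isoToAG {π = π} σ (f , iso) = f ↔-∘ σ , λ L →
  ⇔-trans (iso _) (isAGLine-cong λ q → lookup∘tabulate (lookup L ∘ (σ ⟨$⟩ˡ_)) (Inverse.from f q))

orbit-isoToAG : {r : GF (suc k)} (σ : Permutation′ n) → IsoToAG r π → ∀ d → IsoToAG r (orbit σ π d)
orbit-isoToAG σ iso zero    = iso
orbit-isoToAG σ iso (suc d) = pullback-isoToAG σ (orbit-isoToAG σ iso d)

labels : {r : GF (suc k)} {π : Plane n} → IsoToAG r π → Vec (AGPoint (suc k)) n
labels (f , _) = tabulate (Inverse.to f)

lineSubset : GF (suc k) → Vec (AGPoint (suc k)) n → AGLine k → Subset n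
lineSubset r v ℓ = mapᵛ (onLine r ℓ) v

lookup-lineSubset : (r : GF (suc k)) (g : Fin n → AGPoint (suc k)) (ℓ : AGLine k) (a : Fin n)
  → lookup (lineSubset r (tabulate g) ℓ) a ≡ onLine r ℓ (g a)
lookup-lineSubset r g ℓ a = trans (lookup-map a (onLine r ℓ) (tabulate g)) (cong (onLine r ℓ) (lookup∘tabulate g a))

isoToAG-lines : {r : GF (suc k)} {π : Plane n} (i : IsoToAG r π) {L : Subset n} → π L ⇔ ∃ λ ℓ → L ≡ lineSubset r (labels i) ℓ
isoToAG-lines {r = r} i@(f , iso) {L} = ⇔-trans (iso L) (⇔-trans isAGLine⇔ (mk⇔ to from))
  where
  open Inverse f using (strictlyInverseˡ; strictlyInverseʳ)
  to : ∃ (λ ℓ → lookup L ∘ Inverse.from f ≗ onLine r ℓ) → ∃ λ ℓ → L ≡ lineSubset r (labels i) ℓ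
  to (ℓ , L≗) = ℓ , lookup-ext λ a → begin
    lookup L a                                   ≡⟨ cong (lookup L) (strictlyInverseʳ a) ⟨
    lookup L (Inverse.from f (Inverse.to f a))   ≡⟨ L≗ (Inverse.to f a) ⟩
    onLine r ℓ (Inverse.to f a)                  ≡⟨ lookup-lineSubset r (Inverse.to f) ℓ a ⟨
    lookup (lineSubset r (labels i) ℓ) a         ∎
    where open ≡-Reasoning
  from : ∃ (λ ℓ → L ≡ lineSubset r (labels i) ℓ) → ∃ λ ℓ → lookup L ∘ Inverse.from f ≗ onLine r ℓ
  from (ℓ , refl) = ℓ , λ q →
    trans (lookup-lineSubset r (Inverse.to f) ℓ (Inverse.from f q)) (cong (onLine r ℓ) (strictlyInverseˡ q))

∷↔ : {A : Set} → (A × Vec A k) ↔ Vec A (suc k)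
∷↔ = mk↔ₛ′ (uncurry _∷_) (λ { (x ∷ xs) → x , xs }) (λ { (x ∷ xs) → refl }) (λ _ → refl)

digits : ∀ k → Fin (2 ^ k) ↔ GF k
digits zero    = mk↔ₛ′ (λ _ → []) (λ _ → zero) (λ { [] → refl }) (λ { zero → refl })
digits (suc k) = ∷↔ ↔-∘ ((2↔Bool ×-↔ digits k) ↔-∘ *↔×)

grid : ∀ k → Fin (2 ^ k * 2 ^ k) ↔ AGPoint k
grid k = (digits k ×-↔ digits k) ↔-∘ *↔×

module _ {A : Set} (e : Fin n ↔ A) {P : A → Set} (P? : Decidable P) where
  open Inverse e using (to; from; strictlyInverseˡ)

  all-↔? : Dec (∀ x → P x)
  all-↔? = map′ (λ ∀P x → subst P (strictlyInverseˡ x) (∀P (from x))) (λ ∀P → ∀P ∘ to) (all? (P? ∘ to))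

  any-↔? : Dec (∃ P)
  any-↔? = map′ (λ (a , Pa) → to a , Pa) (λ (x , Px) → from x , subst P (sym (strictlyInverseˡ x)) Px) (any? (P? ∘ to))

allGF : ∀ k → List (GF k)
allGF k = map (Inverse.to (digits k)) (allFin (2 ^ k))

∈-allGF : ∀ (x : GF k) → x ∈ˡ allGF k
∈-allGF {k} x = subst (_∈ˡ allGF k) (Inverse.strictlyInverseˡ (digits k) x) (∈-map⁺ _ (∈-allFin _))

allLines : ∀ k → List (AGLine k)
allLines k = cartesianProductWith nonVertical (allGF (suc k)) (allGF (suc k)) ++ map vertical (allGF (suc k))

∈-allLines : ∀ (ℓ : AGLine k) → ℓ ∈ˡ allLines k
∈-allLines (nonVertical m b) = ∈-++⁺ˡ (∈-cartesianProductWith⁺ nonVertical (∈-allGF m) (∈-allGF b))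
∈-allLines (vertical c)      = ∈-++⁺ʳ _ (∈-map⁺ vertical (∈-allGF c))

anyLine? : {P : AGLine k → Set} → Decidable P → Dec (∃ P)
anyLine? P? = map′ satisfied (λ (ℓ , Pℓ) → lose (∈-allLines ℓ) Pℓ) (anyˡ? P? (allLines _))

-- Deciding orthogovality

lineSubsets : GF (suc k) → Vec (AGPoint (suc k)) n → List (Subset n)
lineSubsets r v = map (lineSubset r v) (allLines _)

MeetInAtMostTwo : List (Subset n) → List (Subset n) → Set
MeetInAtMostTwo Ls Ms = All (λ L → All (λ M → ∣ L ∩ M ∣ ≤ 2) Ms) Ls

-- Taking Ms as an argument lets evaluation share its subsets across all L.
meetInAtMostTwo? : (Ls Ms : List (Subset n)) → Dec (MeetInAtMostTwo Ls Ms)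
meetInAtMostTwo? Ls Ms = All.all? (λ L → All.all? (λ M → ∣ L ∩ M ∣ ≤? 2) Ms) Ls

isoToAG-orthogoval : {r : GF (suc k)} (i₁ : IsoToAG r π₁) (i₂ : IsoToAG r π₂)
  → MeetInAtMostTwo (lineSubsets r (labels i₁)) (lineSubsets r (labels i₂)) → Orthogoval π₁ π₂
isoToAG-orthogoval i₁ i₂ meet L₁ L₂ π₁L₁ π₂L₂
  with ℓ₁ , refl ← Equivalence.to (isoToAG-lines i₁) π₁L₁
  with ℓ₂ , refl ← Equivalence.to (isoToAG-lines i₂) π₂L₂
  = All.lookup (All.lookup meet (∈-map⁺ _ (∈-allLines ℓ₁))) (∈-map⁺ _ (∈-allLines ℓ₂))

module LabelledOrbit (r : GF (suc k)) (f : Fin n ↔ AGPoint (suc k)) (σ : Permutation′ n) where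

  plane : ℕ → Plane n
  plane = orbit σ (labelledAG r f)

  plane-isoToAG : ∀ d → IsoToAG r (plane d)
  plane-isoToAG = orbit-isoToAG σ (labelledAG-isoToAG {f = f})

  meetsBase? : ∀ d → Dec (MeetInAtMostTwo (lineSubsets r (labels (plane-isoToAG 0))) (lineSubsets r (labels (plane-isoToAG d))))
  meetsBase? d = meetInAtMostTwo? _ _

  family : (m : ℕ) → True (all? λ (d : Fin m) → (0 <? toℕ d) →-dec meetsBase? (toℕ d))
    → Σ (Fin m → Plane n) λ π → (∀ i → IsoToAG r (π i)) × MutuallyOrthogoval π
  family m meets = plane ∘ toℕ , plane-isoToAG ∘ toℕ , orbit-mutuallyOrthogoval σ λ d 0<d →
    isoToAG-orthogoval (plane-isoToAG 0) (plane-isoToAG (toℕ d)) (toWitness meets d 0<d)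

FourPointLineThrough : GF (suc k) → AGPoint (suc k) → AGPoint (suc k) → Set
FourPointLineThrough r p q = ∃ λ ℓ → (OnLine r ℓ p × OnLine r ℓ q)
  × ∃₂ λ s t → (OnLine r ℓ s × OnLine r ℓ t) × Unique (p ∷ q ∷ s ∷ t ∷ [])

fourPointLineThrough? : (r : GF (suc k)) (p q : AGPoint (suc k)) → Dec (FourPointLineThrough r p q)
fourPointLineThrough? r p q = anyLine? λ ℓ → (on? ℓ p ×-dec on? ℓ q) ×-dec
  any-↔? (grid _) λ s → any-↔? (grid _) λ t → (on? ℓ s ×-dec on? ℓ t) ×-dec unique? _≟ᴾ_ (p ∷ q ∷ s ∷ t ∷ [])
  where
  on? : ∀ ℓ x → Dec (OnLine r ℓ x)
  on? ℓ x = onLine r ℓ x ≟ᴮ true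

ag4-fourPointLineThrough : ∀ p q → p ≢ q → FourPointLineThrough r4 p q
ag4-fourPointLineThrough = from-yes $
  all-↔? (grid 2) λ p → all-↔? (grid 2) λ q → ¬? (p ≟ᴾ q) →-dec fourPointLineThrough? r4 p q

lookup₂-injective : {A : Set} {s t : A} → s ≢ t → Injective _≡_ _≡_ (lookup (s ∷ t ∷ []))
lookup₂-injective s≢t {zero}     {zero}     _ = refl
lookup₂-injective s≢t {zero}     {suc zero} e = ⊥-elim (s≢t e)
lookup₂-injective s≢t {suc zero} {zero}     e = ⊥-elim (s≢t (sym e))
lookup₂-injective s≢t {suc zero} {suc zero} _ = refl

isoToAG-lineThrough : {r : GF (suc k)} {π : Plane n} {a b : Fin n} → IsoToAG r π
  → (∀ p q → p ≢ q → FourPointLineThrough r p q) → a ≢ b → LineThrough π a b 2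
isoToAG-lineThrough {r = r} {a = a} {b = b} i@(f , _) four a≢b
  with ℓ , (a-on , b-on) , s , t , (s-on , t-on) , ((_ ∷ a≢s ∷ a≢t ∷ []) ∷ (b≢s ∷ b≢t ∷ []) ∷ (s≢t ∷ []) ∷ _)
       ← four (Inverse.to f a) (Inverse.to f b) (a≢b ∘ Injection.injective (↔⇒↣ f))
  = record
    { line            = lineSubset r (labels i) ℓ
    ; isLine          = Equivalence.from (isoToAG-lines i) (ℓ , refl)
    ; a∈line          = on⇒∈ a-on
    ; b∈line          = on⇒∈ b-on
    ; extra           = from ∘ lookup (s ∷ t ∷ [])
    ; extra-injective = lookup₂-injective s≢t ∘ Injection.injective (↔⇒↣ (↔-sym f))
    ; extra∈line      = λ { zero → on-from s-on ; (suc zero) → on-from t-on }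
    ; extra≢a         = λ { zero e → a≢s (inverseˡ (sym e)) ; (suc zero) e → a≢t (inverseˡ (sym e)) }
    ; extra≢b         = λ { zero e → b≢s (inverseˡ (sym e)) ; (suc zero) e → b≢t (inverseˡ (sym e)) }
    }
  where
  open Inverse f using (to; from; inverseˡ; strictlyInverseˡ)
  on⇒∈ : ∀ {x} → OnLine r ℓ (to x) → x ∈ lineSubset r (labels i) ℓ
  on⇒∈ {x} on = lookup⇒[]= x _ (trans (lookup-lineSubset r to ℓ x) on)
  on-from : ∀ {y} → OnLine r ℓ y → from y ∈ lineSubset r (labels i) ℓ
  on-from {y} on = on⇒∈ (subst (OnLine r ℓ) (sym (strictlyInverseˡ y)) on)

-- The two families of seven planes

module _ {n : ℕ} where
  open import Function.Endo.Propositional (Fin n) using () renaming (_^_ to _^ᶠ_)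

  periodicPermutation : (s : Fin n → Fin n) (e : ℕ)
    → True (all? λ a → s ((s ^ᶠ e) a) ≟ᶠ a) → True (all? λ a → (s ^ᶠ e) (s a) ≟ᶠ a) → Permutation′ n
  periodicPermutation s e l r = permutation s (s ^ᶠ e) (toWitness l) (toWitness r)

-- The tables list σ(0), σ(1), …; point 2ᵏx + y of `grid k` is (x , y), reading the first
-- coefficient of x and of y as the most significant binary digit.
σ₄ : Permutation′ 16
σ₄ = periodicPermutation (lookup table) 6 _ _
  where
  table : Vec (Fin 16) 16
  table = # 0 ∷ # 1 ∷ # 4 ∷ # 5 ∷ # 8 ∷ # 9 ∷ # 12 ∷ # 13 ∷ # 6 ∷ # 7 ∷ # 2 ∷ # 3 ∷ # 14 ∷ # 15 ∷ # 10 ∷ # 11 ∷ []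

module Order4 = LabelledOrbit r4 (grid 2) σ₄

σ₈ : Permutation′ 64
σ₈ = periodicPermutation (lookup table) 6 _ _
  where
  table : Vec (Fin 64) 64
  table =
    # 0 ∷ # 40 ∷ # 46 ∷ # 6 ∷ # 51 ∷ # 27 ∷ # 29 ∷ # 53 ∷ # 56 ∷ # 16 ∷ # 22 ∷ # 62 ∷ # 11 ∷ # 35 ∷ # 37 ∷ # 13 ∷
    # 61 ∷ # 21 ∷ # 19 ∷ # 59 ∷ # 14 ∷ # 38 ∷ # 32 ∷ # 8 ∷ # 5 ∷ # 45 ∷ # 43 ∷ # 3 ∷ # 54 ∷ # 30 ∷ # 24 ∷ # 48 ∷
    # 42 ∷ # 2 ∷ # 4 ∷ # 44 ∷ # 25 ∷ # 49 ∷ # 55 ∷ # 31 ∷ # 18 ∷ # 58 ∷ # 60 ∷ # 20 ∷ # 33 ∷ # 9 ∷ # 15 ∷ # 39 ∷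
    # 23 ∷ # 63 ∷ # 57 ∷ # 17 ∷ # 36 ∷ # 12 ∷ # 10 ∷ # 34 ∷ # 47 ∷ # 7 ∷ # 1 ∷ # 41 ∷ # 28 ∷ # 52 ∷ # 50 ∷ # 26 ∷ []

module Order8 = LabelledOrbit r8 (grid 3) σ₈

2+m*2≤16⇒m≤7 : 2 + m * 2 ≤ 16 → m ≤ 7
2+m*2≤16⇒m≤7 {m} bound = *-cancelʳ-≤ m 7 2 (+-cancelˡ-≤ 2 (m * 2) 14 bound)

theorem3p19 :
    -- (i) order 4: every mutually orthogoval family of planes ≅ AG(2,4) on a 16-point set has ≤ 7 members, and 7 is attained
    ( ( ∀ (m : ℕ) (π : Fin m → Plane 16)
          → (∀ i → IsoToAG r4 (π i)) → MutuallyOrthogoval π → m ≤ 7 )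
      × Σ (Fin 7 → Plane 16) (λ π → (∀ i → IsoToAG r4 (π i)) × MutuallyOrthogoval π ) )
    -- (ii) order 8: seven mutually orthogoval planes ≅ AG(2,8) on a 64-point set exist
    × Σ (Fin 7 → Plane 64) (λ π → (∀ i → IsoToAG r8 (π i)) × MutuallyOrthogoval π )
theorem3p19 = (at-most-seven-planes , Order4.family 7 _) , Order8.family 7 _
  where
  0≢1 : zero ≢ suc zero
  0≢1 ()
  at-most-seven-planes : ∀ m (π : Fin m → Plane 16) → (∀ i → IsoToAG r4 (π i)) → MutuallyOrthogoval π → m ≤ 7
  at-most-seven-planes m π isos mo = 2+m*2≤16⇒m≤7 $ mutuallyOrthogoval-bound 0≢1
    (λ i → isoToAG-lineThrough (isos i) ag4-fourPointLineThrough 0≢1) mo
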